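{- Let $n\ge 3$ with $n\neq 4$, and let $2\le k<n$. Then $$\operatorname{Det}(\mathrm{PX}(n,k))=\begin{cases}\lceil n/k\rceil, & \text{if } k\neq n/2,\\ \lceil n/k\rceil+1=3, & \text{if } k=n/2.\end{cases}$$
   Context: For integers $n\ge 3$ and $1\le k<n$, the Praeger–Xu graph $\mathrm{PX}(n,k)$ is the simple graph with vertex set $\mathbb Z_n\times\mathbb Z_2^k$; a vertex is written $(i,x)$ with $x=x_0x_1\cdots x_{k-1}$ a bitstring of length $k$. Two vertices $(i,x)$ and $(j,y)$ are adjacent if and only if (after possibly swapping the two vertices) $j=i+1$ in $\mathbb Z_n$ and $x=az_1\cdots z_{k-1}$, $y=z_1\cdots z_{k-1}b$ for some bits $a,b,z_1,\dots,z_{k-1}\in\mathbb Z_2$. For a graph $G$, a set $S\subseteq V(G)$ is a determining set if the only automorphism of $G$ fixing every vertex of $S$ is the identity; $\operatorname{Det}(G)$ is the minimum size of a determining set. -}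

module Defs where

open import Data.Nat using (ℕ; zero; suc; _+_; _*_; _∸_; _<_; NonZero)
open import Data.Nat.DivMod using (_/_)
open import Data.Nat.Properties using (<-trans; n<1+n)
open import Data.Fin using (Fin; toℕ; fromℕ<)
open import Data.Vec using (Vec; lookup)
open import Data.Bool using (Bool)
open import Data.Product using (_×_; _,_)
open import Data.Sum using (_⊎_)
open import Data.List using (List; length)
open import Data.List.Relation.Unary.Unique.Propositional using (Unique)
open import Data.List.Membership.Propositional using (_∈_)
open import Relation.Binary.PropositionalEquality using (_≡_)
open import Function.Bundles using (_↔_; Inverse; _⇔_)

Vertex : ℕ → ℕ → Set
Vertex n k = Fin n × Vec Bool k

IsSucc : {n : ℕ} → Fin n → Fin n → Set
IsSucc {n} i j = (suc (toℕ i) ≡ toℕ j) ⊎ ((suc (toℕ i) ≡ n) × (toℕ j ≡ 0))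

-- y is obtained from x by shifting left: x = a z_1 … z_{k-1}, y = z_1 … z_{k-1} b,
-- i.e. x_{t+1} = y_t for all 0 ≤ t ≤ k-2.
Shift : {k : ℕ} → Vec Bool k → Vec Bool k → Set
Shift {k} x y = (t : ℕ) (p : suc t < k) →
  lookup x (fromℕ< p) ≡ lookup y (fromℕ< (<-trans (n<1+n t) p))

Arc : (n k : ℕ) → Vertex n k → Vertex n k → Set
Arc n k (i , x) (j , y) = IsSucc i j × Shift x y

Adj : (n k : ℕ) → Vertex n k → Vertex n k → Set
Adj n k u v = Arc n k u v ⊎ Arc n k v u

record Automorphism (n k : ℕ) : Set where
  field
    perm : Vertex n k ↔ Vertex n k
    preserves : ∀ u v → Adj n k u v ⇔ Adj n k (Inverse.to perm u) (Inverse.to perm v)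

IsDetermining : (n k : ℕ) → List (Vertex n k) → Set
IsDetermining n k S = (φ : Automorphism n k) →
  (∀ v → v ∈ S → Inverse.to (Automorphism.perm φ) v ≡ v) →
  ∀ v → Inverse.to (Automorphism.perm φ) v ≡ v

DetIs : (n k m : ℕ) → Set
DetIs n k m =
  (Data.Product.Σ (List (Vertex n k)) λ S → Unique S × IsDetermining n k S × length S ≡ m)
  × ((S : List (Vertex n k)) → Unique S → IsDetermining n k S → m Data.Nat.≤ length S)

⌈_/_⌉ : ℕ → (k : ℕ) → .{{NonZero k}} → ℕ
⌈ n / k ⌉ = (n + k ∸ 1) / k

-- The vertices of PX(n, k) are the windows of length k of words on the n-cycle, and an arc
-- shifts a window by one position.
--
-- If n ≠ 4, a vertex u is the only common neighbour of an in-neighbour and an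
-- out-neighbour of u; and u has the same out-arcs as u with its first bit flipped, and the same
-- in-arcs as u with its last bit flipped.  So an automorphism cannot make two consecutive arcs of a
-- directed path both leave, or both enter, their common vertex: it either preserves or reverses all
-- arcs.  Reversal moves the zero vertex of layer j to layer −j, so fixing the zero vertices of
-- layers 0 and k rules it out unless 2k = n, in which case the zero vertex of layer 1 is fixed as
-- well.  An arc-preserving automorphism fixing the zero vertex of layer 0 preserves layers, and
-- walking at most k − 1 steps from the fixed zero vertices of layers 0, k, 2k, … shows that it
-- fixes every bit.
--
-- Adding a fixed word on the cycle to every window is an automorphism, so the windows
-- of a determining set cover all n positions, whence at least ⌈n/k⌉ vertices.  If n = 2k, two
-- covering windows are complementary, and the reflection of the cycle through the first one,
-- corrected by such an addition, fixes both vertices but moves the zero vertex of the next layer.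

module Submission where

open import Defs
open import Data.Nat using (ℕ; _*_; _+_; _≤_; _<_; NonZero)
open import Relation.Binary.PropositionalEquality using (_≡_; _≢_)
open import Data.Product using (_×_)

open import Data.Nat using (zero; suc; pred; _∸_; _/_; _%_; z≤n; s≤s; s≤s⁻¹; _<?_; _≟_; >-nonZero; >-nonZero⁻¹)
open import Data.Nat.Properties
open import Data.Nat.DivMod
open import Data.Fin using (Fin; toℕ; fromℕ<)
open import Data.Fin.Properties using (toℕ-injective; toℕ-fromℕ<; toℕ<n)
open import Data.Vec using (Vec; []; _∷_; lookup)
open import Data.Bool using (Bool; true; false; not; _xor_)
open import Data.Bool.Properties using (¬-not; not-¬; not-involutive; xor-assoc; xor-same; xor-identityʳ)
open import Data.Product using (∃; _,_; proj₁; proj₂)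
open import Data.Sum using (_⊎_; inj₁; inj₂)
import Data.Sum as Sum
open import Data.Sum.Function.Propositional using (_⊎-⇔_)
open import Data.Empty using (⊥; ⊥-elim)
open import Data.List using (List; []; _∷_; _++_; length; map; concatMap; upTo)
open import Data.List.Properties using (length-++; length-map; length-upTo)
open import Data.List.Relation.Unary.Any using (here; there)
open import Data.List.Relation.Unary.All using (All; []; _∷_)
open import Data.List.Relation.Unary.AllPairs using ([]; _∷_)
open import Data.List.Relation.Unary.Unique.Propositional using (Unique)
open import Data.List.Membership.Propositional using (_∈_)
open import Data.List.Membership.Propositional.Properties
  using (∈-map⁺; ∈-map⁻; ∈-upTo⁺; ∈-upTo⁻; ∈-concat⁺′; ∈-++⁻; ∈-++⁺ˡ; ∈-++⁺ʳ; ∈-∃++)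
open import Data.List.Membership.DecPropositional _≟_ using (_∈?_)
open import Algebra.Properties.CommutativeSemigroup +-commutativeSemigroup using (interchange)
open import Function using (_∘_)
open import Function.Bundles using (_⇔_; mk⇔; Equivalence; Inverse; mk↔ₛ′)
open import Function.Properties.Equivalence using () renaming (refl to ⇔-refl; trans to ⇔-trans)
open import Relation.Nullary using (¬_; yes; no)
open import Relation.Binary.Bundles using (Setoid)
open import Relation.Binary.Construct.Closure.ReflexiveTransitive using (Star; ε; _◅_; _◅◅_; return)
open import Relation.Binary.PropositionalEquality using (refl; sym; trans; cong; cong₂; subst; subst₂)
import Relation.Binary.PropositionalEquality as ≡
import Relation.Binary.Construct.On as On
import Relation.Binary.Reasoning.Setoid as SetoidReasoning

-- Bit strings and words

bitAt : ∀ {k} → Vec Bool k → ℕ → Bool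
bitAt []      t       = false
bitAt (b ∷ w) zero    = b
bitAt (b ∷ w) (suc t) = bitAt w t

fromBits : (k : ℕ) → (ℕ → Bool) → Vec Bool k
fromBits zero    f = []
fromBits (suc k) f = f 0 ∷ fromBits k (f ∘ suc)

bitAt-fromBits : ∀ k f t → t < k → bitAt (fromBits k f) t ≡ f t
bitAt-fromBits (suc k) f zero    _       = refl
bitAt-fromBits (suc k) f (suc t) (s≤s p) = bitAt-fromBits k (f ∘ suc) t p

lookup≡bitAt : ∀ {k} (w : Vec Bool k) t .(p : t < k) → lookup w (fromℕ< p) ≡ bitAt w t
lookup≡bitAt (b ∷ w) zero    p = refl
lookup≡bitAt (b ∷ w) (suc t) p = lookup≡bitAt w t (s≤s⁻¹ p)

bitAt-injective : ∀ {k} (w w′ : Vec Bool k) → (∀ t → t < k → bitAt w t ≡ bitAt w′ t) → w ≡ w′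
bitAt-injective []      []        _ = refl
bitAt-injective (b ∷ w) (b′ ∷ w′) h =
  cong₂ _∷_ (h 0 (s≤s z≤n)) (bitAt-injective w w′ (λ t p → h (suc t) (s≤s p)))

splice : ℕ → (ℕ → Bool) → (ℕ → Bool) → ℕ → Bool
splice j w w′ t with t <? j
... | yes _ = w t
... | no  _ = w′ (t ∸ j)

splice-< : ∀ j w w′ {t} → t < j → splice j w w′ t ≡ w t
splice-< j w w′ {t} t<j with t <? j
... | yes _   = refl
... | no  t≮j = ⊥-elim (t≮j t<j)

splice-+ : ∀ j w w′ t → splice j w w′ (j + t) ≡ w′ t
splice-+ j w w′ t with j + t <? j
... | yes j+t<j = ⊥-elim (m+n≮m j t j+t<j)
... | no  _     = cong w′ (m+n∸m≡n j t)

toggle : ℕ → (ℕ → Bool) → ℕ → Bool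
toggle i w t with t ≟ i
... | yes _ = not (w t)
... | no  _ = w t

toggle-≡ : ∀ i w → toggle i w i ≡ not (w i)
toggle-≡ i w with i ≟ i
... | yes _   = refl
... | no  i≢i = ⊥-elim (i≢i refl)

toggle-≢ : ∀ i w {t} → t ≢ i → toggle i w t ≡ w t
toggle-≢ i w {t} t≢i with t ≟ i
... | yes t≡i = ⊥-elim (t≢i t≡i)
... | no  _   = refl

xor-cancelʳ : ∀ b c → (b xor c) xor c ≡ b
xor-cancelʳ b c = trans (xor-assoc b c c) (trans (cong (b xor_) (xor-same c)) (xor-identityʳ b))

xor-cancelˡ : ∀ b c → b xor (b xor c) ≡ c
xor-cancelˡ b c = trans (sym (xor-assoc b b c)) (cong (_xor c) (xor-same b))

contains-range⇒≤length : ∀ N (W : List ℕ) → (∀ p → p < N → p ∈ W) → N ≤ length W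
contains-range⇒≤length zero    W _  = z≤n
contains-range⇒≤length (suc N) W ⊇ with xs , ys , refl ← ∈-∃++ (⊇ N (n<1+n N)) =
  subst (suc N ≤_) (sym length-split) (s≤s (contains-range⇒≤length N (xs ++ ys) ⊇′))
  where
  length-split : length (xs ++ N ∷ ys) ≡ suc (length (xs ++ ys))
  length-split = trans (length-++ xs) (trans (+-suc (length xs) (length ys)) (cong suc (sym (length-++ xs))))
  ⊇′ : ∀ p → p < N → p ∈ xs ++ ys
  ⊇′ p p<N with ∈-++⁻ xs (⊇ p (m<n⇒m<1+n p<N))
  ... | inj₁ p∈xs         = ∈-++⁺ˡ p∈xs
  ... | inj₂ (here p≡N)   = ⊥-elim (<⇒≢ p<N p≡N)
  ... | inj₂ (there p∈ys) = ∈-++⁺ʳ xs p∈ys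

0<n≤m*k⇒0<m : ∀ {n m k} → 0 < n → n ≤ m * k → 0 < m
0<n≤m*k⇒0<m {m = zero}  0<n n≤0 = ⊥-elim (<⇒≱ 0<n n≤0)
0<n≤m*k⇒0<m {m = suc m} _   _   = s≤s z≤n

k<n≤m*k⇒1<m : ∀ {n m k} → k < n → n ≤ m * k → 1 < m
k<n≤m*k⇒1<m {m = zero}          k<n n≤0   = ⊥-elim (<⇒≱ (≤-<-trans z≤n k<n) n≤0)
k<n≤m*k⇒1<m {m = suc zero} {k}  k<n n≤k+0 = ⊥-elim (<⇒≱ k<n (subst (_ ≤_) (+-identityʳ k) n≤k+0))
k<n≤m*k⇒1<m {m = suc (suc m)}   _   _     = s≤s (s≤s z≤n)

pred[m]∸n<m : ∀ {m} → 0 < m → ∀ n → pred m ∸ n < m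
pred[m]∸n<m {suc m} _ n = s≤s (m∸n≤m m n)

module Modular (n : ℕ) .{{_ : NonZero n}} where

  infix 4 _≋_
  _≋_ : ℕ → ℕ → Set
  a ≋ b = a % n ≡ b % n

  ≋-setoid : Setoid _ _
  ≋-setoid = On.setoid (≡.setoid ℕ) (_% n)

  open Setoid ≋-setoid public using ()
    renaming (refl to ≋-refl; sym to ≋-sym; trans to ≋-trans; reflexive to ≋-reflexive)

  module ≋-Reasoning = SetoidReasoning ≋-setoid

  0<n : 0 < n
  0<n = >-nonZero⁻¹ n

  %-≋ : ∀ a → a % n ≋ a
  %-≋ a = m%n%n≡m%n a n

  +n-≋ : ∀ a → a + n ≋ a
  +n-≋ a = [m+n]%n≡m%n a n

  +*n-≋ : ∀ a m → a + m * n ≋ a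
  +*n-≋ a m = [m+kn]%n≡m%n a m n

  +-congʳ-≋ : ∀ {a b} c → a ≋ b → a + c ≋ b + c
  +-congʳ-≋ {a} {b} c a≋b = begin
    (a + c) % n             ≡⟨ %-distribˡ-+ a c n ⟩
    (a % n + c % n) % n     ≡⟨ cong (λ x → (x + c % n) % n) a≋b ⟩
    (b % n + c % n) % n     ≡⟨ %-distribˡ-+ b c n ⟨
    (b + c) % n             ∎
    where open ≡.≡-Reasoning

  +-congˡ-≋ : ∀ c {a b} → a ≋ b → c + a ≋ c + b
  +-congˡ-≋ c {a} {b} a≋b = begin
    c + a  ≡⟨ +-comm c a ⟩
    a + c  ≈⟨ +-congʳ-≋ c a≋b ⟩
    b + c  ≡⟨ +-comm b c ⟩
    c + b  ∎
    where open ≋-Reasoning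

  +-cong-≋ : ∀ {a b c d} → a ≋ b → c ≋ d → a + c ≋ b + d
  +-cong-≋ {b = b} {c} a≋b c≋d = ≋-trans (+-congʳ-≋ c a≋b) (+-congˡ-≋ b c≋d)

  +-cancelʳ-≋ : ∀ {a b} c → a + c ≋ b + c → a ≋ b
  +-cancelʳ-≋ {a} {b} c e = begin
    a                    ≈⟨ +*n-≋ a c ⟨
    a + c * n            ≡⟨ split a ⟩
    a + c + (c * n ∸ c)  ≈⟨ +-congʳ-≋ (c * n ∸ c) e ⟩
    b + c + (c * n ∸ c)  ≡⟨ split b ⟨
    b + c * n            ≈⟨ +*n-≋ b c ⟩
    b                    ∎
    where
    open ≋-Reasoning
    split : ∀ x → x + c * n ≡ x + c + (c * n ∸ c)
    split x = trans (cong (x +_) (sym (m+[n∸m]≡n (m≤m*n c n)))) (sym (+-assoc x c _))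

  +-cancelˡ-≋ : ∀ c {a b} → c + a ≋ c + b → a ≋ b
  +-cancelˡ-≋ c {a} {b} e = +-cancelʳ-≋ c (subst₂ _≋_ (+-comm c a) (+-comm c b) e)

  ≋⇒≡ : ∀ {a b} → a < n → b < n → a ≋ b → a ≡ b
  ≋⇒≡ {a} {b} a<n b<n e = trans (sym (m<n⇒m%n≡m a<n)) (trans e (m<n⇒m%n≡m b<n))

  +≋-self⇒≋0 : ∀ a c → a + c ≋ a → c ≋ 0
  +≋-self⇒≋0 a c e = +-cancelˡ-≋ a (trans e (cong (_% n) (sym (+-identityʳ a))))

  2≉0 : 3 ≤ n → ¬ 2 ≋ 0
  2≉0 3≤n e with ≋⇒≡ 3≤n 0<n e
  ... | ()

  4≉0 : 3 ≤ n → n ≢ 4 → ¬ 4 ≋ 0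
  4≉0 3≤n n≢4 e with n ≟ 3
  ... | yes refl = case-n≡3 e
    where
    case-n≡3 : ¬ 4 % 3 ≡ 0
    case-n≡3 ()
  ... | no n≢3 with ≋⇒≡ 4<n 0<n e
    where
    4<n : 4 < n
    4<n = ≤∧≢⇒< (≤∧≢⇒< 3≤n (n≢3 ∘ sym)) (n≢4 ∘ sym)
  ...   | ()

  ≋0⇒≡n : ∀ {c} → 0 < c → c < n + n → c ≋ 0 → c ≡ n
  ≋0⇒≡n {c} 0<c c<2n e with c <? n
  ... | yes c<n = ⊥-elim (<⇒≢ 0<c (sym (≋⇒≡ c<n 0<n e)))
  ... | no  c≮n = ≤-antisym (m∸n≡0⇒m≤n c∸n≡0) (≮⇒≥ c≮n)
    where
    c∸n≡0 : c ∸ n ≡ 0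
    c∸n≡0 = ≋⇒≡ (m<n+o⇒m∸n<o c n c<2n) 0<n (trans (m≤n⇒[n∸m]%m≡n%m (≮⇒≥ c≮n)) e)

module PX (n k : ℕ) .{{_ : NonZero n}} where

  open Modular n public

  layer : Vertex n k → ℕ
  layer = toℕ ∘ proj₁

  bit : Vertex n k → ℕ → Bool
  bit = bitAt ∘ proj₂

  layer<n : ∀ u → layer u < n
  layer<n u = toℕ<n (proj₁ u)

  vertex : ℕ → (ℕ → Bool) → Vertex n k
  vertex ℓ w = ℓ mod n , fromBits k w

  layer-vertex : ∀ ℓ w → layer (vertex ℓ w) ≡ ℓ % n
  layer-vertex ℓ w = toℕ-fromℕ< _

  layer-vertex-≋ : ∀ ℓ w → layer (vertex ℓ w) ≋ ℓ
  layer-vertex-≋ ℓ w = trans (cong (_% n) (layer-vertex ℓ w)) (%-≋ ℓ)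

  layer-vertex-layer : ∀ u w → layer (vertex (layer u) w) ≡ layer u
  layer-vertex-layer u w = trans (layer-vertex (layer u) w) (m<n⇒m%n≡m (layer<n u))

  bit-vertex : ∀ ℓ w t → t < k → bit (vertex ℓ w) t ≡ w t
  bit-vertex ℓ w = bitAt-fromBits k w

  vertex-ext : ∀ {u v} → layer u ≡ layer v → (∀ t → t < k → bit u t ≡ bit v t) → u ≡ v
  vertex-ext {i , x} {j , y} e h = cong₂ _,_ (toℕ-injective e) (bitAt-injective x y h)

  vertex-cong : ∀ {ℓ ℓ′ w w′} → ℓ ≋ ℓ′ → (∀ t → t < k → w t ≡ w′ t) → vertex ℓ w ≡ vertex ℓ′ w′
  vertex-cong {ℓ} {ℓ′} {w} {w′} e h = vertex-ext
    (≋⇒≡ (layer<n (vertex ℓ w)) (layer<n (vertex ℓ′ w′)) (≋-trans (layer-vertex-≋ ℓ w) (≋-trans e (≋-sym (layer-vertex-≋ ℓ′ w′)))))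
    (λ t p → trans (bit-vertex ℓ w t p) (trans (h t p) (sym (bit-vertex ℓ′ w′ t p))))

  vertex-η : ∀ u → vertex (layer u) (bit u) ≡ u
  vertex-η u = vertex-ext (layer-vertex-layer u (bit u)) (bit-vertex (layer u) (bit u))

  infix 4 _⟶_ _~_

  record _⟶_ (u v : Vertex n k) : Set where
    constructor arc
    field
      layer-suc : layer v ≋ suc (layer u)
      shift     : ∀ t → suc t < k → bit u (suc t) ≡ bit v t

  open _⟶_ public

  _~_ : Vertex n k → Vertex n k → Set
  u ~ v = u ⟶ v ⊎ v ⟶ u

  IsSucc⇔≋suc : ∀ (i j : Fin n) → IsSucc i j ⇔ (toℕ j ≋ suc (toℕ i))
  IsSucc⇔≋suc i j = mk⇔ to from
    where
    to : IsSucc i j → toℕ j ≋ suc (toℕ i)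
    to (inj₁ e)         = cong (_% n) (sym e)
    to (inj₂ (e₁ , e₂)) = begin
      toℕ j      ≡⟨ e₂ ⟩
      0          ≈⟨ +n-≋ 0 ⟨
      n          ≡⟨ e₁ ⟨
      suc (toℕ i) ∎
      where open ≋-Reasoning
    from : toℕ j ≋ suc (toℕ i) → IsSucc i j
    from e with suc (toℕ i) <? n
    ... | yes i+1<n = inj₁ (sym (≋⇒≡ (toℕ<n j) i+1<n e))
    ... | no  i+1≮n = inj₂ (i+1≡n , ≋⇒≡ (toℕ<n j) 0<n (≋-trans e (≋-trans (≋-reflexive i+1≡n) (+n-≋ 0))))
      where
      i+1≡n : suc (toℕ i) ≡ n
      i+1≡n = ≤-antisym (toℕ<n i) (≮⇒≥ i+1≮n)

  Shift⇔bitAt : ∀ (x y : Vec Bool k) → Shift x y ⇔ (∀ t → suc t < k → bitAt x (suc t) ≡ bitAt y t)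
  Shift⇔bitAt x y = mk⇔
    (λ s t p → trans (sym (lookup≡bitAt x (suc t) p)) (trans (s t p) (lookup≡bitAt y t _)))
    (λ h t p → trans (lookup≡bitAt x (suc t) p) (trans (h t p) (sym (lookup≡bitAt y t _))))

  Arc⇔⟶ : ∀ u v → Arc n k u v ⇔ u ⟶ v
  Arc⇔⟶ (i , x) (j , y) = mk⇔
    (λ (s , h) → arc (to (IsSucc⇔≋suc i j) s) (to (Shift⇔bitAt x y) h))
    (λ (arc e h) → from (IsSucc⇔≋suc i j) e , from (Shift⇔bitAt x y) h)
    where open Equivalence

  Adj⇔~ : ∀ u v → Adj n k u v ⇔ u ~ v
  Adj⇔~ u v = Arc⇔⟶ u v ⊎-⇔ Arc⇔⟶ v u

  automorphism : (h h⁻¹ : Vertex n k → Vertex n k) →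
                 (∀ u → h (h⁻¹ u) ≡ u) → (∀ u → h⁻¹ (h u) ≡ u) →
                 (∀ u v → u ~ v → h u ~ h v) → (∀ u v → u ~ v → h⁻¹ u ~ h⁻¹ v) →
                 Automorphism n k
  automorphism h h⁻¹ hh⁻¹ h⁻¹h h~ h⁻¹~ = record
    { perm      = mk↔ₛ′ h h⁻¹ hh⁻¹ h⁻¹h
    ; preserves = λ u v → mk⇔
        (λ a → from (Adj⇔~ (h u) (h v)) (h~ u v (to (Adj⇔~ u v) a)))
        (λ a → subst₂ (Adj n k) (h⁻¹h u) (h⁻¹h v)
                 (from (Adj⇔~ (h⁻¹ (h u)) (h⁻¹ (h v))) (h⁻¹~ (h u) (h v) (to (Adj⇔~ (h u) (h v)) a))))
    }
    where open Equivalence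

  vertex-⟶ : ∀ ℓ w ℓ′ w′ → ℓ′ ≋ suc ℓ → (∀ t → suc t < k → w (suc t) ≡ w′ t) →
             vertex ℓ w ⟶ vertex ℓ′ w′
  vertex-⟶ ℓ w ℓ′ w′ e h = arc layers bits
    where
    layers : layer (vertex ℓ′ w′) ≋ suc (layer (vertex ℓ w))
    layers = begin
      layer (vertex ℓ′ w′)     ≈⟨ layer-vertex-≋ ℓ′ w′ ⟩
      ℓ′                       ≈⟨ e ⟩
      suc ℓ                    ≈⟨ +-congˡ-≋ 1 (layer-vertex-≋ ℓ w) ⟨
      suc (layer (vertex ℓ w)) ∎
      where open ≋-Reasoning
    bits : ∀ t → suc t < k → bit (vertex ℓ w) (suc t) ≡ bit (vertex ℓ′ w′) t
    bits t p = trans (bit-vertex ℓ w (suc t) p)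
                 (trans (h t p) (sym (bit-vertex ℓ′ w′ t (<-trans (n<1+n t) p))))

  walk : ℕ → (ℕ → Bool) → ℕ → Vertex n k
  walk ℓ w j = vertex (j + ℓ) (λ t → w (j + t))

  walk-⟶ : ∀ ℓ w j → walk ℓ w j ⟶ walk ℓ w (suc j)
  walk-⟶ ℓ w j = vertex-⟶ (j + ℓ) (λ t → w (j + t)) (suc j + ℓ) (λ t → w (suc j + t)) ≋-refl (λ t _ → cong w (+-suc j t))

  walk-star : ∀ ℓ w j → Star _⟶_ (walk ℓ w 0) (walk ℓ w j)
  walk-star ℓ w zero    = ε
  walk-star ℓ w (suc j) = walk-star ℓ w j ◅◅ return (walk-⟶ ℓ w j)

  zeros : ℕ → Vertex n k
  zeros ℓ = vertex ℓ (λ _ → false)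

  zeros-⟶ : ∀ ℓ → zeros ℓ ⟶ zeros (suc ℓ)
  zeros-⟶ ℓ = walk-⟶ ℓ (λ _ → false) 0

  layer-zeros : ∀ {ℓ} → ℓ < n → layer (zeros ℓ) ≡ ℓ
  layer-zeros {ℓ} ℓ<n = trans (layer-vertex ℓ (λ _ → false)) (m<n⇒m%n≡m ℓ<n)

  zeros-injective : ∀ {a b} → a < n → b < n → zeros a ≡ zeros b → a ≡ b
  zeros-injective a<n b<n e = trans (sym (layer-zeros a<n)) (trans (cong layer e) (layer-zeros b<n))

  walk-splice-end : ∀ ℓ j v → j + ℓ ≋ layer v → walk ℓ (splice j (λ _ → false) (bit v)) j ≡ v
  walk-splice-end ℓ j v e = trans (vertex-cong e (λ t _ → splice-+ j _ _ t)) (vertex-η v)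

  reachable : ∀ ℓ v → Star _⟶_ (zeros ℓ) v
  reachable ℓ v = subst₂ (Star _⟶_) start end (walk-star ℓ word j)
    where
    m = (k + ℓ) * n
    j = layer v + (m ∸ ℓ)
    word = splice j (λ _ → false) (bit v)
    k≤j : k ≤ j
    k≤j = ≤-trans (m+n≤o⇒m≤o∸n k (m≤m*n (k + ℓ) n)) (m≤n+m (m ∸ ℓ) (layer v))
    j+ℓ≡ : j + ℓ ≡ layer v + m
    j+ℓ≡ = trans (+-assoc (layer v) (m ∸ ℓ) ℓ)
                 (cong (layer v +_) (m∸n+n≡m (≤-trans (m≤n+m ℓ k) (m≤m*n (k + ℓ) n))))
    start : walk ℓ word 0 ≡ zeros ℓ
    start = vertex-cong ≋-refl (λ t t<k → splice-< j _ _ (<-≤-trans t<k k≤j))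
    end : walk ℓ word j ≡ v
    end = walk-splice-end ℓ j v (≋-trans (≋-reflexive j+ℓ≡) (+*n-≋ (layer v) (k + ℓ)))

  twist : (ℕ → Bool) → Vertex n k → Vertex n k
  twist c u = vertex (layer u) (λ t → bit u t xor c ((layer u + t) % n))

  layer-twist : ∀ c u → layer (twist c u) ≡ layer u
  layer-twist c u = layer-vertex-layer u (λ t → bit u t xor c ((layer u + t) % n))

  bit-twist : ∀ c u t → t < k → bit (twist c u) t ≡ bit u t xor c ((layer u + t) % n)
  bit-twist c u = bit-vertex (layer u) (λ t → bit u t xor c ((layer u + t) % n))

  twist-involutive : ∀ c u → twist c (twist c u) ≡ u
  twist-involutive c u = vertex-ext (trans (layer-twist c (twist c u)) (layer-twist c u)) bits
    where
    open ≡.≡-Reasoning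
    bits : ∀ t → t < k → bit (twist c (twist c u)) t ≡ bit u t
    bits t p = begin
      bit (twist c (twist c u)) t                             ≡⟨ bit-twist c (twist c u) t p ⟩
      bit (twist c u) t xor c ((layer (twist c u) + t) % n)   ≡⟨ cong₂ _xor_ (bit-twist c u t p)
                                                                   (cong (λ ℓ → c ((ℓ + t) % n)) (layer-twist c u)) ⟩
      (bit u t xor c ((layer u + t) % n)) xor c ((layer u + t) % n) ≡⟨ xor-cancelʳ _ _ ⟩
      bit u t                                                 ∎

  twist-⟶ : ∀ c {u v} → u ⟶ v → twist c u ⟶ twist c v
  twist-⟶ c {u} {v} (arc e s) = arc layers bits
    where
    layers : layer (twist c v) ≋ suc (layer (twist c u))
    layers = subst₂ (λ x y → x ≋ suc y) (sym (layer-twist c v)) (sym (layer-twist c u)) e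
    position : ∀ t → layer u + suc t ≋ layer v + t
    position t = ≋-trans (≋-reflexive (+-suc (layer u) t)) (+-congʳ-≋ t (≋-sym e))
    bits : ∀ t → suc t < k → bit (twist c u) (suc t) ≡ bit (twist c v) t
    bits t p = trans (bit-twist c u (suc t) p)
                 (trans (cong₂ _xor_ (s t p) (cong c (position t)))
                        (sym (bit-twist c v t (<-trans (n<1+n t) p))))

  twist-~ : ∀ c u v → u ~ v → twist c u ~ twist c v
  twist-~ c u v = Sum.map (twist-⟶ c {u} {v}) (twist-⟶ c {v} {u})

  twistAutomorphism : (ℕ → Bool) → Automorphism n k
  twistAutomorphism c =
    automorphism (twist c) (twist c) (twist-involutive c) (twist-involutive c) (twist-~ c) (twist-~ c)

  -- Layers are reflected by ℓ ↦ C − ℓ, written C + n ∸ ℓ so that nothing is truncated (ℓ < n).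
  reflect : ℕ → Vertex n k → Vertex n k
  reflect C u = vertex (C + n ∸ layer u) (λ t → bit u (pred k ∸ t))

  layer-reflect : ∀ C u → layer (reflect C u) + layer u ≋ C
  layer-reflect C u = begin
    layer (reflect C u) + layer u  ≈⟨ +-congʳ-≋ (layer u) (layer-vertex-≋ (C + n ∸ layer u) (λ t → bit u (pred k ∸ t))) ⟩
    C + n ∸ layer u + layer u      ≡⟨ m∸n+n≡m (≤-trans (<⇒≤ (layer<n u)) (m≤n+m n C)) ⟩
    C + n                          ≈⟨ +n-≋ C ⟩
    C                              ∎
    where open ≋-Reasoning

  layer-determined : ∀ {C} u v w → layer v + layer u ≋ C → layer w + layer u ≋ C → layer v ≡ layer w
  layer-determined u v w e e′ =
    ≋⇒≡ (layer<n v) (layer<n w) (+-cancelʳ-≋ (layer u) (≋-trans e (≋-sym e′)))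

  bit-reflect : ∀ C u t → t < k → bit (reflect C u) t ≡ bit u (pred k ∸ t)
  bit-reflect C u = bit-vertex (C + n ∸ layer u) (λ t → bit u (pred k ∸ t))

  reflect-involutive : ∀ C u → reflect C (reflect C u) ≡ u
  reflect-involutive C u = vertex-ext
    (layer-determined (reflect C u) (reflect C (reflect C u)) u
      (layer-reflect C (reflect C u))
      (≋-trans (≋-reflexive (+-comm (layer u) _)) (layer-reflect C u)))
    λ t p → trans (bit-reflect C (reflect C u) t p)
              (trans (bit-reflect C u (pred k ∸ t) (pred[m]∸n<m (≤-<-trans z≤n p) t))
                     (cong (bit u) (m∸[m∸n]≡n (<⇒≤pred p))))

  reflect-⟶ : ∀ C {u v} → u ⟶ v → reflect C v ⟶ reflect C u
  reflect-⟶ C {u} {v} (arc e s) = arc layers bits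
    where
    layers : layer (reflect C u) ≋ suc (layer (reflect C v))
    layers = +-cancelʳ-≋ (layer u) (≋-trans (layer-reflect C u) (≋-sym (begin
      suc (layer (reflect C v)) + layer u  ≡⟨ +-suc (layer (reflect C v)) (layer u) ⟨
      layer (reflect C v) + suc (layer u)  ≈⟨ +-congˡ-≋ (layer (reflect C v)) e ⟨
      layer (reflect C v) + layer v        ≈⟨ layer-reflect C v ⟩
      C                                    ∎)))
      where open ≋-Reasoning
    bits : ∀ t → suc t < k → bit (reflect C v) (suc t) ≡ bit (reflect C u) t
    bits t p = trans (bit-reflect C v (suc t) p)
                 (trans (sym (s (pred k ∸ suc t) (subst (_< k) (sym shifted) (pred[m]∸n<m (≤-<-trans z≤n p) t))))
                        (trans (cong (bit u) shifted) (sym (bit-reflect C u t (<-trans (n<1+n t) p)))))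
      where
      shifted : suc (pred k ∸ suc t) ≡ pred k ∸ t
      shifted = sym (+-∸-assoc 1 (<⇒≤pred p))

  reflect-~ : ∀ C u v → u ~ v → reflect C u ~ reflect C v
  reflect-~ C u v = Sum.swap ∘ Sum.map (reflect-⟶ C {u} {v}) (reflect-⟶ C {v} {u})

  reflectTwistAutomorphism : ℕ → (ℕ → Bool) → Automorphism n k
  reflectTwistAutomorphism C c = automorphism (twist c ∘ reflect C) (reflect C ∘ twist c)
    (λ u → trans (cong (twist c) (reflect-involutive C (twist c u))) (twist-involutive c u))
    (λ u → trans (cong (reflect C) (twist-involutive c (reflect C u))) (reflect-involutive C u))
    (λ u v → twist-~ c (reflect C u) (reflect C v) ∘ reflect-~ C u v)
    (λ u v → reflect-~ C (twist c u) (twist c v) ∘ twist-~ c u v)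

  mirrorDefect : Vertex n k → ℕ → Bool
  mirrorDefect u t = bit u (pred k ∸ t) xor bit u t

  reflectTwist-fixes : ∀ C c u → layer u + layer u ≋ C →
                       (∀ t → t < k → c ((layer u + t) % n) ≡ mirrorDefect u t) →
                       twist c (reflect C u) ≡ u
  reflectTwist-fixes C c u e h = vertex-ext (trans (layer-twist c (reflect C u)) same-layer) λ t p →
    trans (bit-twist c (reflect C u) t p)
      (trans (cong₂ _xor_ (bit-reflect C u t p) (cong (λ ℓ → c ((ℓ + t) % n)) same-layer))
        (trans (cong (bit u (pred k ∸ t) xor_) (h t p)) (xor-cancelˡ (bit u (pred k ∸ t)) (bit u t))))
    where
    same-layer : layer (reflect C u) ≡ layer u
    same-layer = layer-determined u (reflect C u) u (layer-reflect C u) e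

  reflectTwist-fixed-layer : ∀ C c v → twist c (reflect C v) ≡ v → layer v + layer v ≋ C
  reflectTwist-fixed-layer C c v fixed = subst (λ ℓ → ℓ + layer v ≋ C) fixed-layer (layer-reflect C v)
    where
    fixed-layer : layer (reflect C v) ≡ layer v
    fixed-layer = trans (sym (layer-twist c (reflect C v))) (cong layer fixed)

  flip : ℕ → Vertex n k → Vertex n k
  flip i u = vertex (layer u) (toggle i (bit u))

  layer-flip : ∀ i u → layer (flip i u) ≡ layer u
  layer-flip i u = layer-vertex-layer u (toggle i (bit u))

  bit-flip-≡ : ∀ {i} u → i < k → bit (flip i u) i ≡ not (bit u i)
  bit-flip-≡ {i} u p = trans (bit-vertex (layer u) (toggle i (bit u)) i p) (toggle-≡ i (bit u))

  bit-flip-≢ : ∀ {i} u {t} → t < k → t ≢ i → bit (flip i u) t ≡ bit u t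
  bit-flip-≢ {i} u {t} p t≢i = trans (bit-vertex (layer u) (toggle i (bit u)) t p) (toggle-≢ i (bit u) t≢i)

  flip-≢ : ∀ {i} u → i < k → flip i u ≢ u
  flip-≢ u p e = not-¬ refl (sym (trans (sym (bit-flip-≡ u p)) (cong (λ x → bit x _) e)))

  flip-first-⟶ : ∀ {u a} → u ⟶ a → flip 0 u ⟶ a
  flip-first-⟶ {u} (arc e s) = arc (subst (λ ℓ → _ ≋ suc ℓ) (sym (layer-flip 0 u)) e)
    λ t p → trans (bit-flip-≢ u p (λ ())) (s t p)

  flip-last-⟶ : ∀ {a u} → a ⟶ u → a ⟶ flip (pred k) u
  flip-last-⟶ {a} {u} (arc e s) = arc (subst (_≋ suc (layer a)) (sym (layer-flip (pred k) u)) e)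
    λ t p → trans (s t p) (sym (bit-flip-≢ u (<-trans (n<1+n t) p) (<⇒≢ (<⇒≤pred p))))

  grid : ℕ → List (Vertex n k)
  grid zero    = []
  grid (suc m) = zeros (m * k) ∷ grid m

  length-grid : ∀ m → length (grid m) ≡ m
  length-grid zero    = refl
  length-grid (suc m) = cong suc (length-grid m)

  ∈-grid : ∀ {j m} → j < m → zeros (j * k) ∈ grid m
  ∈-grid {j} {suc m} j<1+m with j ≟ m
  ... | yes refl = here refl
  ... | no  j≢m  = there (∈-grid (≤∧≢⇒< (s≤s⁻¹ j<1+m) j≢m))

  grid-unique : .{{_ : NonZero k}} → ∀ m → (∀ j → j < m → j * k < n) → Unique (grid m)
  grid-unique zero    _     = []
  grid-unique (suc m) small = fresh m ≤-refl ∷ grid-unique m (λ j p → small j (m<n⇒m<1+n p))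
    where
    fresh : ∀ i → i ≤ m → All (zeros (m * k) ≢_) (grid i)
    fresh zero    _   = []
    fresh (suc i) i<m = new ∷ fresh i (<⇒≤ i<m)
      where
      ik<mk : i * k < m * k
      ik<mk = *-monoˡ-< k i<m
      new : zeros (m * k) ≢ zeros (i * k)
      new e = <⇒≢ ik<mk (sym (zeros-injective (small m ≤-refl) (<-trans ik<mk (small m ≤-refl)) e))

  window : Vertex n k → List ℕ
  window u = map (λ t → (layer u + t) % n) (upTo k)

  windows : List (Vertex n k) → List ℕ
  windows = concatMap window

  length-windows : ∀ S → length (windows S) ≡ length S * k
  length-windows []      = refl
  length-windows (u ∷ S) = begin
    length (window u ++ windows S)          ≡⟨ length-++ (window u) ⟩
    length (window u) + length (windows S)  ≡⟨ cong₂ _+_ (trans (length-map _ (upTo k)) (length-upTo k))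
                                                         (length-windows S) ⟩
    k + length S * k                        ∎
    where open ≡.≡-Reasoning

  ∈-window⁺ : ∀ u {t} → t < k → (layer u + t) % n ∈ window u
  ∈-window⁺ u p = ∈-map⁺ (λ t → (layer u + t) % n) (∈-upTo⁺ p)

  ∈-window⁻ : ∀ u {p} → p ∈ window u → ∃ λ t → t < k × layer u + t ≋ p
  ∈-window⁻ u p∈ with t , t∈ , refl ← ∈-map⁻ (λ t → (layer u + t) % n) p∈ =
    t , ∈-upTo⁻ t∈ , ≋-sym (%-≋ (layer u + t))

  ∈-windows⁺ : ∀ {p u S} → u ∈ S → p ∈ window u → p ∈ windows S
  ∈-windows⁺ {u = u} u∈S p∈ = ∈-concat⁺′ p∈ (∈-map⁺ window u∈S)

module Rigidity (n k : ℕ) .{{_ : NonZero n}} .{{_ : NonZero k}} (3≤n : 3 ≤ n) (n≢4 : n ≢ 4) (2≤k : 2 ≤ k) where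

  open PX n k

  0<k : 0 < k
  0<k = >-nonZero⁻¹ k

  no-2-cycle : ∀ {u v} → u ⟶ v → v ⟶ u → ⊥
  no-2-cycle {u} {v} (arc e _) (arc e′ _) = 2≉0 3≤n (+≋-self⇒≋0 (layer u) 2 (begin
    layer u + 2          ≡⟨ +-comm (layer u) 2 ⟩
    suc (suc (layer u))  ≈⟨ +-congˡ-≋ 1 e ⟨
    suc (layer v)        ≈⟨ e′ ⟨
    layer u              ∎))
    where open ≋-Reasoning

  common-neighbour-unique : ∀ {u a b w} → u ⟶ a → b ⟶ u → w ~ a → w ~ b → w ≡ u
  common-neighbour-unique {u} {a} {b} {w} (arc ua sa) (arc bu sb) = cases
    where
    open ≋-Reasoning
    a≋b+2 : layer a ≋ layer b + 2
    a≋b+2 = begin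
      layer a              ≈⟨ ua ⟩
      suc (layer u)        ≈⟨ +-congˡ-≋ 1 bu ⟩
      suc (suc (layer b))  ≡⟨ +-comm 2 (layer b) ⟩
      layer b + 2          ∎
    a≉b : ¬ layer a ≋ layer b
    a≉b e = 2≉0 3≤n (+≋-self⇒≋0 (layer b) 2 (≋-trans (≋-sym a≋b+2) e))
    cases : w ~ a → w ~ b → w ≡ u
    cases (inj₁ (arc wa sw)) (inj₂ (arc bw sw′)) =
      vertex-ext (≋⇒≡ (layer<n w) (layer<n u) (+-cancelˡ-≋ 1 (≋-trans (≋-sym wa) ua))) bits
      where
      bits : ∀ t → t < k → bit w t ≡ bit u t
      bits zero    _ = trans (sym (sw′ 0 2≤k)) (sb 0 2≤k)
      bits (suc t) p = trans (sw t p) (sym (sa t p))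
    cases (inj₁ (arc wa _)) (inj₁ (arc wb _)) = ⊥-elim (a≉b (≋-trans wa (≋-sym wb)))
    cases (inj₂ (arc aw _)) (inj₂ (arc bw _)) = ⊥-elim (a≉b (+-cancelˡ-≋ 1 (≋-trans (≋-sym aw) bw)))
    cases (inj₂ (arc aw _)) (inj₁ (arc wb _)) = ⊥-elim (4≉0 3≤n n≢4 (+≋-self⇒≋0 (layer b) 4 (begin
      layer b + 4          ≡⟨ +-assoc (layer b) 2 2 ⟨
      layer b + 2 + 2      ≈⟨ +-congʳ-≋ 2 a≋b+2 ⟨
      layer a + 2          ≡⟨ +-comm (layer a) 2 ⟩
      suc (suc (layer a))  ≈⟨ +-congˡ-≋ 1 aw ⟨
      suc (layer w)        ≈⟨ wb ⟨
      layer b              ∎)))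

  module Orientation (φ : Automorphism n k) where

    f f⁻¹ : Vertex n k → Vertex n k
    f   = Inverse.to (Automorphism.perm φ)
    f⁻¹ = Inverse.from (Automorphism.perm φ)

    f∘f⁻¹ : ∀ x → f (f⁻¹ x) ≡ x
    f∘f⁻¹ x = Inverse.inverseˡ (Automorphism.perm φ) refl

    f-injective : ∀ {u v} → f u ≡ f v → u ≡ v
    f-injective {u} {v} e = trans (sym (Inverse.inverseʳ (Automorphism.perm φ) refl))
                              (trans (cong f⁻¹ e) (Inverse.inverseʳ (Automorphism.perm φ) refl))

    f-~ : ∀ u v → u ~ v → f u ~ f v
    f-~ u v = to (Adj⇔~ (f u) (f v)) ∘ to (Automorphism.preserves φ u v) ∘ from (Adj⇔~ u v)
      where open Equivalence

    f-~⁻ : ∀ u v → f u ~ f v → u ~ v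
    f-~⁻ u v = to (Adj⇔~ u v) ∘ from (Automorphism.preserves φ u v) ∘ from (Adj⇔~ (f u) (f v))
      where open Equivalence

    image-twins-collapse : ∀ {b u a} → b ⟶ u → u ⟶ a → ∀ t → t ~ f a → t ~ f b → t ≡ f u
    image-twins-collapse bu ua t ta tb =
      trans (sym (f∘f⁻¹ t)) (cong f (common-neighbour-unique ua bu (pull ta) (pull tb)))
      where
      pull : ∀ {x} → t ~ f x → f⁻¹ t ~ x
      pull {x} p = f-~⁻ (f⁻¹ t) x (subst (_~ f x) (sym (f∘f⁻¹ t)) p)

    -- Two image arcs both leaving f u (or both entering) would make the twin flip 0 (f u)
    -- (resp. flip (pred k) (f u)) a second common neighbour of the preimages.
    orientation-consistent : ∀ {b u a} → b ⟶ u → u ⟶ a →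
                             (f b ⟶ f u × f u ⟶ f a) ⊎ (f u ⟶ f b × f a ⟶ f u)
    orientation-consistent {b} {u} {a} bu ua with f-~ b u (inj₁ bu) | f-~ u a (inj₁ ua)
    ... | inj₁ p   | inj₁ q   = inj₁ (p , q)
    ... | inj₂ p   | inj₂ q   = inj₂ (p , q)
    ... | inj₂ ub′ | inj₁ ua′ = ⊥-elim (flip-≢ (f u) 0<k
      (image-twins-collapse bu ua _ (inj₁ (flip-first-⟶ ua′)) (inj₁ (flip-first-⟶ ub′))))
    ... | inj₁ bu′ | inj₂ au′ = ⊥-elim (flip-≢ (f u) (pred[m]∸n<m 0<k 0)
      (image-twins-collapse bu ua _ (inj₂ (flip-last-⟶ au′)) (inj₂ (flip-last-⟶ bu′))))

    preserved-forward : ∀ {b u a} → b ⟶ u → u ⟶ a → f b ⟶ f u → f u ⟶ f a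
    preserved-forward bu ua p with orientation-consistent bu ua
    ... | inj₁ (_ , q) = q
    ... | inj₂ (r , _) = ⊥-elim (no-2-cycle p r)

    reversed-forward : ∀ {b u a} → b ⟶ u → u ⟶ a → f u ⟶ f b → f a ⟶ f u
    reversed-forward bu ua r with orientation-consistent bu ua
    ... | inj₁ (p , _) = ⊥-elim (no-2-cycle p r)
    ... | inj₂ (_ , q) = q

    preserved-along : ∀ {b u v a} → b ⟶ u → f b ⟶ f u → Star _⟶_ u v → v ⟶ a → f v ⟶ f a
    preserved-along bu p ε         va = preserved-forward bu va p
    preserved-along bu p (uw ◅ wv) va = preserved-along uw (preserved-forward bu uw p) wv va

    all-arcs-preserved : f (zeros 0) ⟶ f (zeros 1) → ∀ {v a} → v ⟶ a → f v ⟶ f a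
    all-arcs-preserved p {v} = preserved-along (zeros-⟶ 0) p (reachable 1 v)

    zero-path-reversed : f (zeros 1) ⟶ f (zeros 0) → ∀ j → f (zeros (suc j)) ⟶ f (zeros j)
    zero-path-reversed r zero    = r
    zero-path-reversed r (suc j) = reversed-forward (zeros-⟶ j) (zeros-⟶ (suc j)) (zero-path-reversed r j)

    layer-zero-path-reversed : f (zeros 1) ⟶ f (zeros 0) → ∀ j → layer (f (zeros j)) + j ≋ layer (f (zeros 0))
    layer-zero-path-reversed r zero    = ≋-reflexive (+-identityʳ _)
    layer-zero-path-reversed r (suc j) = begin
      layer (f (zeros (suc j))) + suc j    ≡⟨ +-suc (layer (f (zeros (suc j)))) j ⟩
      suc (layer (f (zeros (suc j)))) + j  ≈⟨ +-congʳ-≋ j (layer-suc (zero-path-reversed r j)) ⟨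
      layer (f (zeros j)) + j              ≈⟨ layer-zero-path-reversed r j ⟩
      layer (f (zeros 0))                  ∎
      where open ≋-Reasoning

    zero-arc-preserved : k < n → k + k ≢ n → f (zeros 0) ≡ zeros 0 → f (zeros k) ≡ zeros k →
                         f (zeros 0) ⟶ f (zeros 1)
    zero-arc-preserved k<n k+k≢n fixed₀ fixedₖ with f-~ (zeros 0) (zeros 1) (inj₁ (zeros-⟶ 0))
    ... | inj₁ p = p
    ... | inj₂ r = ⊥-elim (k+k≢n (≋0⇒≡n (+-mono-< 0<k 0<k) (+-mono-< k<n k<n) (begin
      k + k                      ≡⟨ cong (_+ k) (layer-zeros k<n) ⟨
      layer (zeros k) + k        ≡⟨ cong (λ x → layer x + k) fixedₖ ⟨
      layer (f (zeros k)) + k    ≈⟨ layer-zero-path-reversed r k ⟩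
      layer (f (zeros 0))        ≡⟨ cong layer fixed₀ ⟩
      layer (zeros 0)            ≡⟨ layer-zeros 0<n ⟩
      0                          ∎)))
      where open ≋-Reasoning

    module Preserving (preserved : ∀ {u v} → u ⟶ v → f u ⟶ f v) (fixed₀ : f (zeros 0) ≡ zeros 0) where

      layer-preserved : ∀ v → layer (f v) ≡ layer v
      layer-preserved v = along (cong layer fixed₀) (reachable 0 v)
        where
        along : ∀ {x v} → layer (f x) ≡ layer x → Star _⟶_ x v → layer (f v) ≡ layer v
        along e ε = e
        along {x} e (_◅_ {j = y} xy yv) = along (≋⇒≡ (layer<n (f y)) (layer<n y) (begin
          layer (f y)      ≈⟨ layer-suc (preserved xy) ⟩
          suc (layer (f x)) ≡⟨ cong suc e ⟩
          suc (layer x)     ≈⟨ layer-suc xy ⟨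
          layer y           ∎)) yv
          where open ≋-Reasoning

      BitFixed : Vertex n k → ℕ → Set
      BitFixed v t = bit (f v) t ≡ bit v t

      bitFixed-⟶ : ∀ {u u′} → u ⟶ u′ → ∀ t → suc t < k → BitFixed u (suc t) ⇔ BitFixed u′ t
      bitFixed-⟶ uu′ t p = mk⇔
        (λ q → trans (sym (shift (preserved uu′) t p)) (trans q (shift uu′ t p)))
        (λ q → trans (shift (preserved uu′) t p) (trans q (sym (shift uu′ t p))))

      bitFixed-walk : ∀ ℓ w j i → i + j < k → BitFixed (walk ℓ w 0) (j + i) ⇔ BitFixed (walk ℓ w j) i
      bitFixed-walk ℓ w zero    i _ = ⇔-refl
      bitFixed-walk ℓ w (suc j) i p =
        ⇔-trans (subst (λ x → BitFixed (walk ℓ w 0) x ⇔ BitFixed (walk ℓ w 0) (j + suc i)) (+-suc j i) ⇔-refl)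
          (⇔-trans (bitFixed-walk ℓ w j (suc i) p′)
                   (bitFixed-⟶ (walk-⟶ ℓ w j) i (≤-<-trans (m≤m+n (suc i) j) p′)))
        where
        p′ : suc i + j < k
        p′ = subst (_< k) (+-suc i j) p

      -- v and flip 0 v have the same out-neighbours, hence so do their images.
      first-bit-of-twin-images : ∀ v → bit (f v) 0 ≡ not (bit (f (flip 0 v)) 0)
      first-bit-of-twin-images v = ¬-not λ e → flip-≢ v 0<k (sym (f-injective (vertex-ext layers (bits e))))
        where
        v⟶x : v ⟶ walk (layer v) (bit v) 1
        v⟶x = subst (_⟶ walk (layer v) (bit v) 1) (vertex-η v) (walk-⟶ (layer v) (bit v) 0)
        layers : layer (f v) ≡ layer (f (flip 0 v))
        layers = trans (layer-preserved v) (sym (trans (layer-preserved (flip 0 v)) (layer-flip 0 v)))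
        bits : bit (f v) 0 ≡ bit (f (flip 0 v)) 0 → ∀ t → t < k → bit (f v) t ≡ bit (f (flip 0 v)) t
        bits e zero    _ = e
        bits e (suc t) p = trans (shift (preserved v⟶x) t p) (sym (shift (preserved (flip-first-⟶ v⟶x)) t p))

      bitFixed-flip : ∀ v → BitFixed (flip 0 v) 0 → BitFixed v 0
      bitFixed-flip v q = begin
        bit (f v) 0                   ≡⟨ first-bit-of-twin-images v ⟩
        not (bit (f (flip 0 v)) 0)    ≡⟨ cong not q ⟩
        not (bit (flip 0 v) 0)        ≡⟨ cong not (bit-flip-≡ v 0<k) ⟩
        not (not (bit v 0))           ≡⟨ not-involutive (bit v 0) ⟩
        bit v 0                       ∎
        where open ≡.≡-Reasoning

      module _ (zeros-bitFixed : ∀ ℓ → BitFixed (zeros ℓ) 0) where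

        -- x ends a walk of length k − 1 starting at zeros q, so its first bit is the last bit of zeros q.
        bitFixed-first-false : ∀ x → bit x 0 ≡ false → BitFixed x 0
        bitFixed-first-false x x₀≡false =
          subst (λ y → BitFixed y 0) end
            (to (bitFixed-walk q word j 0 j<k) (subst (λ y → BitFixed y (j + 0)) (sym start) zeros-fixed-at-j))
          where
          open Equivalence
          j = pred k
          j<k : j < k
          j<k = pred[m]∸n<m 0<k 0
          q = layer x + k * n ∸ j
          word = splice j (λ _ → false) (bit x)
          start : walk q word 0 ≡ zeros q
          start = vertex-cong ≋-refl word-false
            where
            word-false : ∀ t → t < k → word t ≡ false
            word-false t t<k = Sum.[ splice-< j _ _ , j≤t⇒false ]′ (<-≤-connex t j)
              where
              j≤t⇒false : j ≤ t → word t ≡ false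
              j≤t⇒false j≤t = trans (cong word t≡j+0) (trans (splice-+ j _ _ 0) x₀≡false)
                where
                t≡j+0 : t ≡ j + 0
                t≡j+0 = trans (≤-antisym (<⇒≤pred t<k) j≤t) (sym (+-identityʳ j))
          end : walk q word j ≡ x
          end = walk-splice-end q j x (≋-trans (≋-reflexive (m+[n∸m]≡n j≤)) (+*n-≋ (layer x) k))
            where
            j≤ : j ≤ layer x + k * n
            j≤ = ≤-trans (<⇒≤ j<k) (≤-trans (m≤m*n k n) (m≤n+m (k * n) (layer x)))
          zeros-fixed-at-j : BitFixed (zeros q) (j + 0)
          zeros-fixed-at-j = from (bitFixed-walk q (λ _ → false) j 0 j<k) (zeros-bitFixed (j + q))

        bitFixed-first : ∀ x → BitFixed x 0
        bitFixed-first x = by-first-bit (bit x 0) refl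
          where
          by-first-bit : ∀ b → bit x 0 ≡ b → BitFixed x 0
          by-first-bit false x₀ = bitFixed-first-false x x₀
          by-first-bit true  x₀ =
            bitFixed-flip x (bitFixed-first-false (flip 0 x) (trans (bit-flip-≡ x 0<k) (cong not x₀)))

        fixes-everything : ∀ v → f v ≡ v
        fixes-everything v = vertex-ext (layer-preserved v) λ t p →
          subst₂ BitFixed (vertex-η v) (+-identityʳ t)
            (Equivalence.from (bitFixed-walk (layer v) (bit v) t 0 p) (bitFixed-first _))

  grid-fixed⇒identity : (φ : Automorphism n k) → let open Orientation φ in
    ∀ m → n ≤ m * k → (∀ j → j < m → f (zeros (j * k)) ≡ zeros (j * k)) →
    f (zeros 0) ⟶ f (zeros 1) → ∀ v → f v ≡ v
  grid-fixed⇒identity φ m n≤mk fixed p = fixes-everything zeros-bitFixed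
    where
    open Orientation φ
    0<m = 0<n≤m*k⇒0<m 0<n n≤mk
    open Preserving (all-arcs-preserved p) (fixed 0 0<m)
    zeros-bitFixed : ∀ ℓ → BitFixed (zeros ℓ) 0
    zeros-bitFixed ℓ = subst (λ x → BitFixed x 0) zeros-r≡zeros-ℓ
      (Equivalence.to (bitFixed-walk (j * k) (λ _ → false) d 0 d<k)
        (subst (BitFixed (zeros (j * k))) (sym (+-identityʳ d)) (cong (λ x → bit x d) (fixed j j<m))))
      where
      r = ℓ % n
      j = r / k
      d = r % k
      d<k : d < k
      d<k = m%n<n r k
      j<m : j < m
      j<m = m<n*o⇒m/o<n (<-≤-trans (m%n<n ℓ n) n≤mk)
      zeros-r≡zeros-ℓ : zeros (d + j * k) ≡ zeros ℓ
      zeros-r≡zeros-ℓ = vertex-cong (≋-trans (≋-reflexive (sym (m≡m%n+[m/n]*n r k))) (%-≋ ℓ)) (λ _ _ → refl)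

  grid-determining : k < n → k + k ≢ n → ∀ m → n ≤ m * k → IsDetermining n k (grid m)
  grid-determining k<n k+k≢n m n≤mk φ fixes = grid-fixed⇒identity φ m n≤mk fixed
    (zero-arc-preserved k<n k+k≢n (fixed 0 (0<n≤m*k⇒0<m 0<n n≤mk))
      (subst (λ x → f (zeros x) ≡ zeros x) (*-identityˡ k) (fixed 1 (k<n≤m*k⇒1<m k<n n≤mk))))
    where
    open Orientation φ
    fixed : ∀ j → j < m → f (zeros (j * k)) ≡ zeros (j * k)
    fixed j p = fixes _ (∈-grid p)

  zeros₁∷grid-determining : ∀ m → n ≤ m * k → IsDetermining n k (zeros 1 ∷ grid m)
  zeros₁∷grid-determining m n≤mk φ fixes = grid-fixed⇒identity φ m n≤mk
    (λ j p → fixes _ (there (∈-grid p)))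
    (subst₂ _⟶_ (sym (fixes _ (there (∈-grid (0<n≤m*k⇒0<m 0<n n≤mk))))) (sym (fixes _ (here refl)))
      (zeros-⟶ 0))

module LowerBound (n k : ℕ) .{{_ : NonZero n}} .{{_ : NonZero k}} where

  open PX n k

  0<k : 0 < k
  0<k = >-nonZero⁻¹ k

  -- A position p of the cycle outside every window of S can be toggled without moving S.
  determining⇒covering : ∀ S → IsDetermining n k S → ∀ p → p < n → p ∈ windows S
  determining⇒covering S det p p<n with p ∈? windows S
  ... | yes p∈ = p∈
  ... | no  p∉ = ⊥-elim (moved (det (twistAutomorphism c) fixes (zeros p)))
    where
    c = toggle p (λ _ → false)
    fixes : ∀ v → v ∈ S → twist c v ≡ v
    fixes v v∈S = vertex-ext (layer-twist c v) λ t t<k →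
      trans (bit-twist c v t t<k)
        (trans (cong (bit v t xor_) (toggle-≢ p _ λ e → p∉ (∈-windows⁺ v∈S (subst (_∈ window v) e (∈-window⁺ v t<k)))))
               (xor-identityʳ (bit v t)))
    position : (layer (zeros p) + 0) % n ≡ p
    position = trans (cong (_% n) (trans (+-identityʳ _) (layer-zeros p<n))) (m<n⇒m%n≡m p<n)
    moved : twist c (zeros p) ≢ zeros p
    moved e = not-¬ refl (sym (begin
      not false                                           ≡⟨ toggle-≡ p _ ⟨
      c p                                                 ≡⟨ cong c position ⟨
      c ((layer (zeros p) + 0) % n)                       ≡⟨ cong (_xor c ((layer (zeros p) + 0) % n)) (bit-vertex p (λ _ → false) 0 0<k) ⟨
      bit (zeros p) 0 xor c ((layer (zeros p) + 0) % n)   ≡⟨ bit-twist c (zeros p) 0 0<k ⟨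
      bit (twist c (zeros p)) 0                           ≡⟨ cong (λ v → bit v 0) e ⟩
      bit (zeros p) 0                                     ≡⟨ bit-vertex p (λ _ → false) 0 0<k ⟩
      false                                               ∎))
      where open ≡.≡-Reasoning

  determining⇒n≤length*k : ∀ S → IsDetermining n k S → n ≤ length S * k
  determining⇒n≤length*k S det =
    subst (n ≤_) (length-windows S) (contains-range⇒≤length n (windows S) (determining⇒covering S det))

module Halving (n k : ℕ) .{{_ : NonZero n}} .{{_ : NonZero k}} (3≤n : 3 ≤ n) (k+k≡n : k + k ≡ n) where

  open PX n k
  open LowerBound n k

  k<n : k < n
  k<n = subst (k <_) k+k≡n (m<m+n k 0<k)

  1<k : 1 < k
  1<k = ≰⇒> λ k≤1 → <⇒≱ 3≤n (subst (_≤ 2) k+k≡n (+-mono-≤ k≤1 k≤1))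

  in-window-of-second : ∀ a b → (∀ p → p < n → p ∈ windows (a ∷ b ∷ [])) →
                        ∀ d → k ≤ d → d < n → ∃ λ t → t < k × layer b + t ≋ layer a + d
  in-window-of-second a b covers d k≤d d<n with ∈-++⁻ (window a) (covers _ (m%n<n (layer a + d) n))
  ... | inj₁ ∈a with t , t<k , e ← ∈-window⁻ a ∈a =
    ⊥-elim (<⇒≱ t<k (≤-trans k≤d (≤-reflexive (sym t≡d))))
    where
    t≡d : t ≡ d
    t≡d = ≋⇒≡ (<-trans t<k k<n) d<n (+-cancelˡ-≋ (layer a) (≋-trans e (%-≋ (layer a + d))))
  ... | inj₂ ∈b++[] with ∈-++⁻ (window b) ∈b++[]
  ...   | inj₁ ∈b with t , t<k , e ← ∈-window⁻ b ∈b = t , t<k , ≋-trans e (%-≋ (layer a + d))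
  ...   | inj₂ ()

  -- The window of b contains the positions layer a + k and layer a − 1, which are k − 1 apart.
  complementary-windows : ∀ a b → (∀ p → p < n → p ∈ windows (a ∷ b ∷ [])) → layer b ≋ layer a + k
  complementary-windows a b covers
    with t₁ , t₁<k , e₁ ← in-window-of-second a b covers k ≤-refl k<n
       | t₂ , t₂<k , e₂ ← in-window-of-second a b covers (n ∸ 1) (<⇒≤pred k<n) (pred[m]∸n<m 0<n 0) = begin
    layer b          ≡⟨ +-identityʳ (layer b) ⟨
    layer b + 0      ≡⟨ cong (layer b +_) t₁≡0 ⟨
    layer b + t₁     ≈⟨ e₁ ⟩
    layer a + k      ∎
    where
    open ≋-Reasoning
    via-t₂ : layer b + (t₂ + 1) ≋ layer a
    via-t₂ = begin
      layer b + (t₂ + 1)     ≡⟨ +-assoc (layer b) t₂ 1 ⟨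
      layer b + t₂ + 1       ≈⟨ +-congʳ-≋ 1 e₂ ⟩
      layer a + (n ∸ 1) + 1  ≡⟨ trans (+-assoc (layer a) (n ∸ 1) 1) (cong (layer a +_) (m∸n+n≡m 0<n)) ⟩
      layer a + n            ≈⟨ +n-≋ (layer a) ⟩
      layer a                ∎
    via-t₁ : layer b + (t₁ + k) ≋ layer a
    via-t₁ = begin
      layer b + (t₁ + k)     ≡⟨ +-assoc (layer b) t₁ k ⟨
      layer b + t₁ + k       ≈⟨ +-congʳ-≋ k e₁ ⟩
      layer a + k + k        ≡⟨ trans (+-assoc (layer a) k k) (cong (layer a +_) k+k≡n) ⟩
      layer a + n            ≈⟨ +n-≋ (layer a) ⟩
      layer a                ∎
    t₂+1≤k : t₂ + 1 ≤ k
    t₂+1≤k = subst (_≤ k) (+-comm 1 t₂) t₂<k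
    t₂+1≡t₁+k : t₂ + 1 ≡ t₁ + k
    t₂+1≡t₁+k = ≋⇒≡ (≤-<-trans t₂+1≤k k<n) (subst (t₁ + k <_) k+k≡n (+-monoˡ-< k t₁<k))
                     (+-cancelˡ-≋ (layer b) (≋-trans via-t₂ (≋-sym via-t₁)))
    t₁≡0 : t₁ ≡ 0
    t₁≡0 = n≤0⇒n≡0 (+-cancelʳ-≤ k t₁ 0 (subst (_≤ k) t₂+1≡t₁+k t₂+1≤k))

  reflection-offset : ∀ a {q} d → d < n → q ≋ layer a + d → (q + n ∸ layer a) % n ≡ d
  reflection-offset a {q} d d<n e = trans (+-cancelʳ-≋ (layer a) (begin
    q + n ∸ layer a + layer a   ≡⟨ m∸n+n≡m (≤-trans (<⇒≤ (layer<n a)) (m≤n+m n q)) ⟩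
    q + n                       ≈⟨ +n-≋ q ⟩
    q                           ≈⟨ e ⟩
    layer a + d                 ≡⟨ +-comm (layer a) d ⟩
    d + layer a                 ∎)) (m<n⇒m%n≡m d<n)
    where open ≋-Reasoning

  -- At offset d from layer a: the mirror defect of a for d < k, that of b at offset k + t.
  pairCorrection : Vertex n k → Vertex n k → ℕ → Bool
  pairCorrection a b q = splice k (mirrorDefect a) (mirrorDefect b) ((q + n ∸ layer a) % n)

  pair-fixed : ∀ a b → layer b ≋ layer a + k →
               ∀ u → u ∈ a ∷ b ∷ [] → twist (pairCorrection a b) (reflect (layer a + layer a) u) ≡ u
  pair-fixed a b Lb≋La+k _ (here refl) = reflectTwist-fixes (layer a + layer a) (pairCorrection a b) a ≋-refl λ t t<k →
    trans (cong (splice k (mirrorDefect a) (mirrorDefect b)) (reflection-offset a t (<-trans t<k k<n) (%-≋ (layer a + t))))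
          (splice-< k _ _ t<k)
  pair-fixed a b Lb≋La+k _ (there (here refl)) = reflectTwist-fixes (layer a + layer a) (pairCorrection a b) b Lb+Lb≋C λ t t<k →
    trans (cong (splice k (mirrorDefect a) (mirrorDefect b)) (reflection-offset a (k + t) (subst (k + t <_) k+k≡n (+-monoʳ-< k t<k)) (begin
      (layer b + t) % n   ≈⟨ %-≋ (layer b + t) ⟩
      layer b + t         ≈⟨ +-congʳ-≋ t Lb≋La+k ⟩
      layer a + k + t     ≡⟨ +-assoc (layer a) k t ⟩
      layer a + (k + t)   ∎)))
      (splice-+ k _ _ t)
    where
    open ≋-Reasoning
    Lb+Lb≋C : layer b + layer b ≋ layer a + layer a
    Lb+Lb≋C = begin
      layer b + layer b                ≈⟨ +-cong-≋ Lb≋La+k Lb≋La+k ⟩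
      (layer a + k) + (layer a + k)    ≡⟨ interchange (layer a) k (layer a) k ⟩
      (layer a + layer a) + (k + k)    ≡⟨ cong (layer a + layer a +_) k+k≡n ⟩
      (layer a + layer a) + n          ≈⟨ +n-≋ (layer a + layer a) ⟩
      layer a + layer a                ∎

  -- The automorphism of pair-fixed reflects layers through layer a, so it moves layer a + 1.
  two-vertices-not-determining : ∀ a b → ¬ IsDetermining n k (a ∷ b ∷ [])
  two-vertices-not-determining a b det = 2≉0 3≤n (+≋-self⇒≋0 C 2 (begin
    C + 2                            ≡⟨ +-comm C 2 ⟩
    suc (suc (layer a + layer a))    ≡⟨ cong suc (+-suc (layer a) (layer a)) ⟨
    suc (layer a) + suc (layer a)    ≈⟨ +-cong-≋ v-layer v-layer ⟨
    layer v + layer v                ≈⟨ reflectTwist-fixed-layer C c v (det (reflectTwistAutomorphism C c) fixes v) ⟩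
    C                                ∎))
    where
    open ≋-Reasoning
    C = layer a + layer a
    c = pairCorrection a b
    fixes = pair-fixed a b (complementary-windows a b (determining⇒covering _ det))
    v = zeros (suc (layer a))
    v-layer : layer v ≋ suc (layer a)
    v-layer = layer-vertex-≋ (suc (layer a)) (λ _ → false)

  at-least-three : ∀ S → IsDetermining n k S → 3 ≤ length S
  at-least-three []          det = ⊥-elim (<⇒≱ 0<n (determining⇒n≤length*k [] det))
  at-least-three (_ ∷ [])    det =
    ⊥-elim (<⇒≱ k<n (subst (n ≤_) (+-identityʳ k) (determining⇒n≤length*k (_ ∷ []) det)))
  at-least-three (a ∷ b ∷ []) det = ⊥-elim (two-vertices-not-determining a b det)
  at-least-three (_ ∷ _ ∷ _ ∷ _) _ = s≤s (s≤s (s≤s z≤n))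

  zeros₁∷grid₂-unique : Unique (zeros 1 ∷ grid 2)
  zeros₁∷grid₂-unique =
    (distinct 1<n (small 1 ≤-refl) (λ e → <⇒≢ 1<k (trans e (*-identityˡ k))) ∷ distinct 1<n 0<n (λ ()) ∷ [])
    ∷ grid-unique 2 small
    where
    1<n : 1 < n
    1<n = <-trans 1<k k<n
    distinct : ∀ {x y} → x < n → y < n → x ≢ y → zeros x ≢ zeros y
    distinct x<n y<n x≢y = x≢y ∘ zeros-injective x<n y<n
    small : ∀ j → j < 2 → j * k < n
    small zero          _ = 0<n
    small (suc zero)    _ = subst (_< n) (sym (+-identityʳ k)) k<n
    small (suc (suc j)) (s≤s (s≤s ()))

-- Ceiling division

module _ {n : ℕ} (k : ℕ) .{{_ : NonZero k}} (0<n : 0 < n) where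

  ⌈/⌉≡1+[n∸1]/k : ⌈ n / k ⌉ ≡ suc ((n ∸ 1) / k)
  ⌈/⌉≡1+[n∸1]/k = begin
    (n + k ∸ 1) / k            ≡⟨ cong (_/ k) (+-∸-comm k 0<n) ⟩
    (n ∸ 1 + k) / k            ≡⟨ m/n≡1+[m∸n]/n (m≤n+m k (n ∸ 1)) ⟩
    suc ((n ∸ 1 + k ∸ k) / k)  ≡⟨ cong (λ x → suc (x / k)) (m+n∸n≡m (n ∸ 1) k) ⟩
    suc ((n ∸ 1) / k)          ∎
    where open ≡.≡-Reasoning

  n≤⌈/⌉*k : n ≤ ⌈ n / k ⌉ * k
  n≤⌈/⌉*k = begin
    n                                    ≡⟨ trans (+-comm 1 (n ∸ 1)) (m∸n+n≡m 0<n) ⟨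
    suc (n ∸ 1)                          ≡⟨ cong suc (m≡m%n+[m/n]*n (n ∸ 1) k) ⟩
    suc ((n ∸ 1) % k + (n ∸ 1) / k * k)  ≤⟨ +-monoˡ-≤ ((n ∸ 1) / k * k) (m%n<n (n ∸ 1) k) ⟩
    k + (n ∸ 1) / k * k                  ≡⟨ cong (_* k) ⌈/⌉≡1+[n∸1]/k ⟨
    ⌈ n / k ⌉ * k                        ∎
    where open ≤-Reasoning

  ⌈/⌉-least : ∀ {l} → n ≤ l * k → ⌈ n / k ⌉ ≤ l
  ⌈/⌉-least n≤lk = subst (_≤ _) (sym ⌈/⌉≡1+[n∸1]/k) (m<n*o⇒m/o<n (<-≤-trans (pred[m]∸n<m 0<n 0) n≤lk))

  j<⌈/⌉⇒j*k<n : ∀ {j} → j < ⌈ n / k ⌉ → j * k < n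
  j<⌈/⌉⇒j*k<n {j} j<⌈n/k⌉ = begin-strict
    j * k              ≤⟨ *-monoˡ-≤ k (s≤s⁻¹ (subst (j <_) ⌈/⌉≡1+[n∸1]/k j<⌈n/k⌉)) ⟩
    (n ∸ 1) / k * k    ≤⟨ m/n*n≤m (n ∸ 1) k ⟩
    n ∸ 1              <⟨ pred[m]∸n<m 0<n 0 ⟩
    n                  ∎
    where open ≤-Reasoning

  ⌈/⌉≡2 : k < n → n ≤ 2 * k → ⌈ n / k ⌉ ≡ 2
  ⌈/⌉≡2 k<n n≤2k = ≤-antisym (⌈/⌉-least n≤2k) (k<n≤m*k⇒1<m k<n n≤⌈/⌉*k)

theorem4p2 : (n k : ℕ) → .{{_ : NonZero k}} → 3 ≤ n → n ≢ 4 → 2 ≤ k → k < n →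
    (2 * k ≢ n → DetIs n k ⌈ n / k ⌉) ×
    (2 * k ≡ n → DetIs n k (⌈ n / k ⌉ + 1) × ⌈ n / k ⌉ + 1 ≡ 3)
theorem4p2 n k 3≤n n≢4 2≤k k<n = unbalanced , balanced
  where
  instance
    n-nonZero : NonZero n
    n-nonZero = >-nonZero (<-trans (s≤s z≤n) 3≤n)
  open PX n k using (zeros; grid; length-grid; grid-unique)
  open Rigidity n k 3≤n n≢4 2≤k using (grid-determining; zeros₁∷grid-determining)
  open LowerBound n k using (determining⇒n≤length*k)
  0<n : 0 < n
  0<n = >-nonZero⁻¹ n
  2*k≡k+k : 2 * k ≡ k + k
  2*k≡k+k = cong (k +_) (+-identityʳ k)

  unbalanced : 2 * k ≢ n → DetIs n k ⌈ n / k ⌉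
  unbalanced 2k≢n =
    ( grid ⌈ n / k ⌉
    , grid-unique _ (λ j → j<⌈/⌉⇒j*k<n k 0<n)
    , grid-determining k<n (2k≢n ∘ trans 2*k≡k+k) _ (n≤⌈/⌉*k k 0<n)
    , length-grid _ )
    , λ S _ det → ⌈/⌉-least k 0<n (determining⇒n≤length*k S det)

  balanced : 2 * k ≡ n → DetIs n k (⌈ n / k ⌉ + 1) × ⌈ n / k ⌉ + 1 ≡ 3
  balanced 2k≡n =
    ( ( zeros 1 ∷ grid 2 , zeros₁∷grid₂-unique , zeros₁∷grid-determining 2 n≤2k , sym ⌈n/k⌉+1≡3 )
    , λ S _ det → subst (_≤ length S) (sym ⌈n/k⌉+1≡3) (at-least-three S det) )
    , ⌈n/k⌉+1≡3
    where
    open Halving n k 3≤n (trans (sym 2*k≡k+k) 2k≡n) using (zeros₁∷grid₂-unique; at-least-three)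
    n≤2k : n ≤ 2 * k
    n≤2k = ≤-reflexive (sym 2k≡n)
    ⌈n/k⌉+1≡3 : ⌈ n / k ⌉ + 1 ≡ 3
    ⌈n/k⌉+1≡3 = cong (_+ 1) (⌈/⌉≡2 k 0<n k<n n≤2k)
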